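{- Let $c$ be any component, and let $s_1,\dots,s_m$ ($m\ge1$) be subtours in $c$, all of the same category, with $\sum_{i=1}^m\bar\ell(s_i)\le1$. Then all terminals visited by the subtours $s_1,\dots,s_m$ can be visited by a single tour (closed walk from $r$) of length at most $D$.
   Context: Setting: a rooted tree $T=(V,E)$ with non-negative integer edge weights, root (depot) $r$, a set $U$ of terminals, and a positive integer distance constraint $D$. Length of a walk is the sum of the weights of traversed edges; $\mathrm{dist}(u,v)$ is the tree distance. The edges of $T$ are partitioned into a set $\mathcal C$ of components such that: each component $c$ is a connected subgraph of $T$, with root $r_c$ its vertex closest to $r$; a component $c$ is a leaf component if all descendants of $r_c$ are in $c$, and internal otherwise; an internal component shares vertices with other components only at $r_c$ and at one other vertex $e_c$, its exit vertex. It is assumed that the denominators below are positive. A subtour in component $c$ is a walk inside $c$ starting and ending at $r_c$ that visits at least one terminal, each edge of it being traversed once in each direction. A subtour $s$ in $c$ has category passing if $c$ is internal and $e_c$ lies on $s$, and category ending otherwise. Its reduced length is $\bar\ell(s)=\frac{\mathrm{length}(s)}{D-2\mathrm{dist}(r,r_c)}$ if $s$ is ending, and $\bar\ell(s)=\frac{\mathrm{length}(s)-2\mathrm{dist}(r_c,e_c)}{D-2\mathrm{dist}(r,e_c)}$ if $s$ is passing. -}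

module Defs where

open import Data.Nat using (ℕ; zero; suc; _+_; _*_; _∸_; _≤_; _<_)
open import Data.Fin using (Fin)
open import Data.Fin.Properties using () renaming (_≟_ to _≟ᶠ_)
open import Data.Bool using (Bool; true; false; _∧_; if_then_else_)
open import Data.Bool.Properties using () renaming (_≟_ to _≟ᵇ_)
open import Data.Product using (Σ; ∃; ∃-syntax; _×_; _,_)
open import Data.Sum using (_⊎_)
open import Data.Unit using (⊤)
open import Data.List using (List; []; _∷_)
open import Data.List.Membership.Propositional using (_∈_)
open import Data.Integer using (ℤ; +_; _-_)
open import Data.Rational using (ℚ; _/_; 0ℚ) renaming (_+_ to _+ℚ_)
open import Relation.Binary.PropositionalEquality using (_≡_; _≢_)
open import Relation.Nullary using (¬_; does)

iter : {A : Set} → (A → A) → ℕ → A → A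
iter f zero x = x
iter f (suc k) x = f (iter f k x)

-- Edges are the pairs {v , parent v} for v ≢ root; such an edge is
-- identified with its child endpoint v, and has weight (weight v).
record RootedTree : Set where
  field
    size        : ℕ
    root        : Fin size
    parent      : Fin size → Fin size
    weight      : Fin size → ℕ
    parent-root : parent root ≡ root
    reaches-root : ∀ v → ∃[ k ] iter parent k v ≡ root

module _ (T : RootedTree) where
  open RootedTree T

  Vtx : Set
  Vtx = Fin size

  Ancestor : Vtx → Vtx → Set
  Ancestor a x = ∃[ k ] iter parent k x ≡ a

  data Adj : Vtx → Vtx → Set where
    up   : ∀ {u} → u ≢ root → Adj u (parent u)
    down : ∀ {v} → v ≢ root → Adj (parent v) v

  edgeOf : ∀ {u v} → Adj u v → Vtx
  edgeOf (up {u} _) = u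
  edgeOf (down {v} _) = v

  isUp : ∀ {u v} → Adj u v → Bool
  isUp (up _) = true
  isUp (down _) = false

  data Walk : Vtx → Vtx → Set where
    stop : ∀ {v} → Walk v v
    step : ∀ {u v w} → Adj u v → Walk v w → Walk u w

  length : ∀ {u v} → Walk u v → ℕ
  length stop = 0
  length (step a w) = weight (edgeOf a) + length w

  vertices : ∀ {u v} → Walk u v → List Vtx
  vertices {u} stop = u ∷ []
  vertices {u} (step a w) = u ∷ vertices w

  -- number of traversals of edge x in direction b (true = upwards)
  traversals : ∀ {u v} → Vtx → Bool → Walk u v → ℕ
  traversals x b stop = 0
  traversals x b (step a w) =
    (if does (edgeOf a ≟ᶠ x) ∧ does (isUp a ≟ᵇ b) then 1 else 0)
    + traversals x b w

  IsTreeDist : (Vtx → Vtx → ℕ) → Set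
  IsTreeDist dist = ∀ u v →
    (Σ (Walk u v) λ w → length w ≡ dist u v) × (∀ (w : Walk u v) → dist u v ≤ length w)

  module _ {k : ℕ} (comp : Vtx → Fin k) where
    EdgeIn : Fin k → Vtx → Set
    EdgeIn c e = e ≢ root × comp e ≡ c

    VertexIn : Fin k → Vtx → Set
    VertexIn c x = ∃[ e ] (EdgeIn c e × (x ≡ e ⊎ x ≡ parent e))

    WalkIn : ∀ {u v} → Fin k → Walk u v → Set
    WalkIn c stop = ⊤
    WalkIn c (step a w) = EdgeIn c (edgeOf a) × WalkIn c w

  -- A partition of the edges into k components (comp e is the component
  -- of edge e; its value at the root is irrelevant), with the component
  -- roots r_c and exit vertices e_c.
  record Components (k : ℕ) : Set where
    field
      comp  : Vtx → Fin k
      croot : Fin k → Vtx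
      exit  : Fin k → Vtx

    IsLeaf : Fin k → Set
    IsLeaf c = ∀ x → Ancestor (croot c) x → VertexIn comp c x

    IsInternal : Fin k → Set
    IsInternal c = ¬ IsLeaf c

    field
      connected : ∀ c x y → VertexIn comp c x → VertexIn comp c y →
                  Σ (Walk x y) (WalkIn comp c)
      croot-in : ∀ c → VertexIn comp c (croot c)
      croot-closest : ∀ c x → VertexIn comp c x → Ancestor (croot c) x
      exit-in : ∀ c → IsInternal c → VertexIn comp c (exit c)
      exit-≢  : ∀ c → IsInternal c → exit c ≢ croot c
      shares-only : ∀ c c' x → IsInternal c → c' ≢ c →
                    VertexIn comp c x → VertexIn comp c' x →
                    x ≡ croot c ⊎ x ≡ exit c

  data Category : Set where
    passing ending : Category

  module _ {k : ℕ} (C : Components k) where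
    open Components C

    IsSubtour : (U : Vtx → Set) (c : Fin k) → Walk (croot c) (croot c) → Set
    IsSubtour U c w =
      WalkIn comp c w
      × (∃[ x ] (U x × x ∈ vertices w))
      × (∀ x → (traversals x true w ≡ 0 × traversals x false w ≡ 0)
             ⊎ (traversals x true w ≡ 1 × traversals x false w ≡ 1))

    HasCategory : (c : Fin k) → Category → Walk (croot c) (croot c) → Set
    HasCategory c passing w = IsInternal c × exit c ∈ vertices w
    HasCategory c ending  w = ¬ (IsInternal c × exit c ∈ vertices w)

-- p / d as a rational (denominator assumed positive; 0 when d = 0)
frac : ℤ → ℕ → ℚ
frac p zero = 0ℚ
frac p (suc d) = p / suc d

reducedLength : (T : RootedTree) (dist : Vtx T → Vtx T → ℕ) (D : ℕ) {k : ℕ}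
  (C : Components T k) (c : Fin k) → Category T →
  Walk T (Components.croot C c) (Components.croot C c) → ℚ
reducedLength T dist D C c (passing) w =
  frac (+ length T w - + (2 * dist (Components.croot C c) (Components.exit C c)))
       (D ∸ 2 * dist (RootedTree.root T) (Components.exit C c))
reducedLength T dist D C c (ending) w =
  frac (+ length T w) (D ∸ 2 * dist (RootedTree.root T) (Components.croot C c))

sumℚ : (m : ℕ) → (Fin m → ℚ) → ℚ
sumℚ zero f = 0ℚ
sumℚ (suc m) f = f Fin.zero +ℚ sumℚ m (λ i → f (Fin.suc i))

{-# OPTIONS --safe #-}
-- Write a for the root of the component and b for its exit vertex in the passing case,
-- and b = a in the ending case; every subtour is a closed walk at a through b, and in
-- both cases the hypothesis says  Σ (length sᵢ - 2 dist(a,b)) ≤ D - 2 dist(r,b).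
-- Start from the walk a → b → a along the tree path P from a to b and splice the
-- subtours into it one by one.  A subtour splits at b into a walk a → b and a walk
-- b → a; each of these is absorbed edge by edge: steps along P are dropped (they are
-- already in the current walk), and every excursion leaving P, which must return
-- through the edge it left by, is spliced in at its base.  The dropped steps connect a
-- and b twice, so each subtour adds at most its length minus 2 dist(a,b).  The closed
-- walk at a so obtained, joined to r by a shortest path, is the required tour.
module Submission where

open import Defs
open import Data.Nat using (ℕ; zero; suc; _+_; _*_; _∸_; _≤_; _<_; s≤s)
import Data.Nat.Properties as ℕP
open import Data.Nat.Induction using (<-wellFounded)
open import Data.Nat.Tactic.RingSolver using (solve-∀)
open import Data.Integer as ℤ using (ℤ; +_)
import Data.Integer.Properties as ℤP
import Data.Integer.Tactic.RingSolver as ℤ-Solver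
open import Data.Rational as ℚ using (1ℚ; _/_; toℚᵘ) renaming (_≤_ to _≤ℚ_)
import Data.Rational.Properties as ℚP
open import Data.Rational.Unnormalised as ℚᵘ using (mkℚᵘ; *≡*; *≤*)
import Data.Rational.Unnormalised.Properties as ℚᵘP
open import Data.Fin using (Fin; fromℕ<)
open import Data.Fin.Properties using () renaming (_≟_ to _≟ᶠ_)
open import Data.Product using (Σ; _×_; _,_; proj₁; proj₂; ∃-syntax)
open import Data.Sum using (_⊎_; inj₁; inj₂; [_,_]′)
open import Data.Empty using (⊥-elim)
open import Data.Unit using (tt)
open import Data.List using (List; []; _∷_)
open import Data.List.Relation.Unary.Any using (here; there)
open import Data.List.Membership.Propositional using (_∈_)
open import Data.List.Relation.Binary.Subset.Propositional using (_⊆_)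
open import Induction.WellFounded using (Acc; acc)
open import Relation.Nullary using (¬_; yes; no)
open import Relation.Binary.PropositionalEquality
open import Function using (id; _∘_; flip)

sumℕ : (m : ℕ) → (Fin m → ℕ) → ℕ
sumℕ zero f = 0
sumℕ (suc m) f = f Fin.zero + sumℕ m (f ∘ Fin.suc)

sumℤ : (m : ℕ) → (Fin m → ℤ) → ℤ
sumℤ zero f = + 0
sumℤ (suc m) f = f Fin.zero ℤ.+ sumℤ m (f ∘ Fin.suc)

mkℚᵘ-+ : ∀ p q n → mkℚᵘ p n ℚᵘ.+ mkℚᵘ q n ℚᵘ.≃ mkℚᵘ (p ℤ.+ q) n
mkℚᵘ-+ p q n = *≡* (identity p q (+ suc n))
  where
  identity : ∀ p q d → (p ℤ.* d ℤ.+ q ℤ.* d) ℤ.* d ≡ (p ℤ.+ q) ℤ.* (d ℤ.* d)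
  identity = ℤ-Solver.solve-∀

sumℚ-frac : ∀ n m (g : Fin m → ℤ) →
  toℚᵘ (sumℚ m (λ i → frac (g i) (suc n))) ℚᵘ.≃ mkℚᵘ (sumℤ m g) n
sumℚ-frac n zero g = *≡* refl
sumℚ-frac n (suc m) g = begin
  toℚᵘ (g Fin.zero / suc n ℚ.+ rest)              ≈⟨ ℚP.toℚᵘ-homo-+ (g Fin.zero / suc n) rest ⟩
  toℚᵘ (g Fin.zero / suc n) ℚᵘ.+ toℚᵘ rest         ≈⟨ ℚᵘP.+-cong (ℚP.toℚᵘ-fromℚᵘ (mkℚᵘ (g Fin.zero) n))
                                                                (sumℚ-frac n m (g ∘ Fin.suc)) ⟩
  mkℚᵘ (g Fin.zero) n ℚᵘ.+ mkℚᵘ (sumℤ m (g ∘ Fin.suc)) n ≈⟨ mkℚᵘ-+ (g Fin.zero) (sumℤ m (g ∘ Fin.suc)) n ⟩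
  mkℚᵘ (sumℤ (suc m) g) n                          ∎
  where
  open ℚᵘP.≃-Reasoning
  rest : ℚ.ℚ
  rest = sumℚ m (λ i → frac (g (Fin.suc i)) (suc n))

sumℚ-frac≤1⇒sumℤ≤ : ∀ N → 0 < N → ∀ m (g : Fin m → ℤ) →
  sumℚ m (λ i → frac (g i) N) ≤ℚ 1ℚ → sumℤ m g ℤ.≤ + N
sumℚ-frac≤1⇒sumℤ≤ (suc n) _ m g sum≤1
  with ℚᵘP.≤-respˡ-≃ (sumℚ-frac n m g) (ℚP.toℚᵘ-mono-≤ sum≤1)
... | *≤* le = subst₂ ℤ._≤_ (ℤP.*-identityʳ _) (ℤP.*-identityˡ _) le

sumℤ-pos : ∀ m (f : Fin m → ℕ) → sumℤ m (λ i → + f i) ≡ + sumℕ m f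
sumℤ-pos zero f = refl
sumℤ-pos (suc m) f = begin
  + f Fin.zero ℤ.+ sumℤ m (λ i → + f (Fin.suc i)) ≡⟨ cong (ℤ._+_ (+ f Fin.zero)) (sumℤ-pos m (f ∘ Fin.suc)) ⟩
  + f Fin.zero ℤ.+ + sumℕ m (f ∘ Fin.suc)         ≡⟨ ℤP.pos-+ (f Fin.zero) _ ⟨
  + sumℕ (suc m) f                                 ∎
  where open ≡-Reasoning

sumℤ-pos-sub : ∀ m (f : Fin m → ℕ) K →
  sumℤ m (λ i → + f i ℤ.- + K) ≡ + sumℕ m f ℤ.- + (m * K)
sumℤ-pos-sub zero f K = refl
sumℤ-pos-sub (suc m) f K = begin
  (+ f₀ ℤ.- + K) ℤ.+ sumℤ m (λ i → + f (Fin.suc i) ℤ.- + K)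
    ≡⟨ cong (ℤ._+_ (+ f₀ ℤ.- + K)) (sumℤ-pos-sub m (f ∘ Fin.suc) K) ⟩
  (+ f₀ ℤ.- + K) ℤ.+ (+ S ℤ.- + (m * K))
    ≡⟨ regroup (+ f₀) (+ S) (+ K) (+ (m * K)) ⟩
  (+ f₀ ℤ.+ + S) ℤ.- (+ K ℤ.+ + (m * K))
    ≡⟨ cong₂ ℤ._-_ (ℤP.pos-+ f₀ S) (ℤP.pos-+ K (m * K)) ⟨
  + sumℕ (suc m) f ℤ.- + (suc m * K) ∎
  where
  open ≡-Reasoning
  f₀ S : ℕ
  f₀ = f Fin.zero
  S = sumℕ m (f ∘ Fin.suc)
  regroup : ∀ a b c d → (a ℤ.- c) ℤ.+ (b ℤ.- d) ≡ (a ℤ.+ b) ℤ.- (c ℤ.+ d)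
  regroup = ℤ-Solver.solve-∀

sumℚ-frac≤1⇒sumℕ≤ : ∀ N → 0 < N → ∀ m (f : Fin m → ℕ) →
  sumℚ m (λ i → frac (+ f i) N) ≤ℚ 1ℚ → sumℕ m f ≤ N
sumℚ-frac≤1⇒sumℕ≤ N N>0 m f sum≤1 =
  ℤP.drop‿+≤+ (subst (ℤ._≤ + N) (sumℤ-pos m f) (sumℚ-frac≤1⇒sumℤ≤ N N>0 m _ sum≤1))

sumℚ-frac-sub≤1⇒sumℕ≤ : ∀ N → 0 < N → ∀ m (f : Fin m → ℕ) K →
  sumℚ m (λ i → frac (+ f i ℤ.- + K) N) ≤ℚ 1ℚ → sumℕ m f ≤ N + m * K
sumℚ-frac-sub≤1⇒sumℕ≤ N N>0 m f K sum≤1 = ℤP.drop‿+≤+ (begin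
  + sumℕ m f                               ≡⟨ sub-add (+ sumℕ m f) (+ (m * K)) ⟨
  (+ sumℕ m f ℤ.- + (m * K)) ℤ.+ + (m * K) ≤⟨ ℤP.+-monoˡ-≤ (+ (m * K)) numerators≤N ⟩
  + N ℤ.+ + (m * K)                        ≡⟨ ℤP.pos-+ N (m * K) ⟨
  + (N + m * K)                            ∎)
  where
  open ℤP.≤-Reasoning
  sub-add : ∀ a b → (a ℤ.- b) ℤ.+ b ≡ a
  sub-add = ℤ-Solver.solve-∀
  numerators≤N : + sumℕ m f ℤ.- + (m * K) ℤ.≤ + N
  numerators≤N = subst (ℤ._≤ + N) (sumℤ-pos-sub m f K) (sumℚ-frac≤1⇒sumℤ≤ N N>0 m _ sum≤1)

+-insert-≤ : ∀ {a b c d} x → a + b ≤ c + d → a + (x + b) ≤ c + (x + d)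
+-insert-≤ {a} {b} {c} {d} x a+b≤c+d =
  subst₂ _≤_ (rearrange a b x) (rearrange c d x) (ℕP.+-monoʳ-≤ x a+b≤c+d)
  where
  rearrange : ∀ p q x → x + (p + q) ≡ p + (x + q)
  rearrange = solve-∀

within-budget : ∀ {ℓ y b σ D} → ℓ + y ≤ b + σ → σ ≤ (D ∸ b) + y → b ≤ D → ℓ ≤ D
within-budget {ℓ} {y} {b} {σ} {D} ℓ+y≤b+σ σ≤ b≤D = ℕP.+-cancelʳ-≤ y ℓ D (begin
  ℓ + y              ≤⟨ ℓ+y≤b+σ ⟩
  b + σ              ≤⟨ ℕP.+-monoʳ-≤ b σ≤ ⟩
  b + ((D ∸ b) + y)  ≡⟨ ℕP.+-assoc b (D ∸ b) y ⟨
  b + (D ∸ b) + y    ≡⟨ cong (_+ y) (ℕP.m+[n∸m]≡n b≤D) ⟩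
  D + y              ∎)
  where open ℕP.≤-Reasoning

iter-suc : ∀ {A : Set} (f : A → A) k x → iter f k (f x) ≡ iter f (suc k) x
iter-suc f zero x = refl
iter-suc f (suc k) x = cong f (iter-suc f k x)

iter-+ : ∀ {A : Set} (f : A → A) m n x → iter f (m + n) x ≡ iter f m (iter f n x)
iter-+ f zero n x = refl
iter-+ f (suc m) n x = cong f (iter-+ f m n x)

iter-cycle-return : ∀ {A : Set} (f : A → A) p y → iter f (suc p) y ≡ y →
  ∀ n → ∃[ j ] iter f j (iter f n y) ≡ y
iter-cycle-return f p y cycle zero = 0 , refl
iter-cycle-return f p y cycle (suc n) with iter-cycle-return f p y cycle n
... | zero , back = p , trans (iter-suc f p _) (subst (λ z → iter f (suc p) z ≡ y) (sym back) cycle)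
... | suc j , back = j , trans (iter-suc f j _) back

module Tree (T : RootedTree) where
  open RootedTree T
  open import Data.List.Membership.DecPropositional (_≟ᶠ_ {size}) using (_∈?_)

  iter-root : ∀ j → iter parent j root ≡ root
  iter-root zero = refl
  iter-root (suc j) = trans (cong parent (iter-root j)) parent-root

  cycle⇒root : ∀ p y → iter parent (suc p) y ≡ y → y ≡ root
  cycle⇒root p y cycle with reaches-root y
  ... | k , reach with iter-cycle-return parent p y cycle k
  ... | j , back = trans (sym back) (trans (cong (iter parent j) reach) (iter-root j))

  ancestor-refl : ∀ x → Ancestor T x x
  ancestor-refl x = 0 , refl

  ancestor-of-parent : ∀ {a x} → Ancestor T a (parent x) → Ancestor T a x
  ancestor-of-parent {x = x} (k , reach) = suc k , trans (sym (iter-suc parent k x)) reach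

  proper-ancestor : ∀ {a x} → Ancestor T a x → x ≢ a → Ancestor T a (parent x)
  proper-ancestor (zero , x≡a) x≢a = ⊥-elim (x≢a x≡a)
  proper-ancestor {x = x} (suc k , reach) _ = k , trans (iter-suc parent k x) reach

  ancestor-antisym : ∀ {a x} → Ancestor T a x → Ancestor T x a → x ≡ a
  ancestor-antisym (zero , x≡a) _ = x≡a
  ancestor-antisym {a} {x} (suc i , x↑a) (j , a↑x) =
    trans (sym a↑x) (trans (cong (iter parent j) a≡root) (trans (iter-root j) (sym a≡root)))
    where
    a≡root : a ≡ root
    a≡root = cycle⇒root (i + j) a
      (trans (iter-+ parent (suc i) j a) (trans (cong (iter parent (suc i)) a↑x) x↑a))

  ¬ancestor-of-parent : ∀ {a} → a ≢ root → ¬ Ancestor T a (parent a)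
  ¬ancestor-of-parent {a} a≢root (k , reach) =
    a≢root (cycle⇒root k a (trans (sym (iter-suc parent k a)) reach))

  infixr 5 _++_
  _++_ : ∀ {u v w} → Walk T u v → Walk T v w → Walk T u w
  stop ++ q = q
  step e p ++ q = step e (p ++ q)

  ++-assoc : ∀ {u v w x} (p : Walk T u v) (q : Walk T v w) (r : Walk T w x) →
    (p ++ q) ++ r ≡ p ++ (q ++ r)
  ++-assoc stop q r = refl
  ++-assoc (step e p) q r = cong (step e) (++-assoc p q r)

  length-++ : ∀ {u v w} (p : Walk T u v) (q : Walk T v w) →
    length T (p ++ q) ≡ length T p + length T q
  length-++ stop q = refl
  length-++ (step e p) q =
    trans (cong (_+_ (weight (edgeOf T e))) (length-++ p q)) (sym (ℕP.+-assoc (weight (edgeOf T e)) _ _))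

  steps : ∀ {u v} → Walk T u v → ℕ
  steps stop = 0
  steps (step e p) = suc (steps p)

  steps-++ʳ : ∀ {u v w} (p : Walk T u v) (q : Walk T v w) → steps q ≤ steps (p ++ q)
  steps-++ʳ stop q = ℕP.≤-refl
  steps-++ʳ (step e p) q = ℕP.m≤n⇒m≤1+n (steps-++ʳ p q)

  head∈vertices : ∀ {u v} (w : Walk T u v) → u ∈ vertices T w
  head∈vertices stop = here refl
  head∈vertices (step e w) = here refl

  vertices-++ˡ : ∀ {u v w} (p : Walk T u v) (q : Walk T v w) → vertices T p ⊆ vertices T (p ++ q)
  vertices-++ˡ stop q (here refl) = head∈vertices q
  vertices-++ˡ (step e p) q (here refl) = here refl
  vertices-++ˡ (step e p) q (there z∈p) = there (vertices-++ˡ p q z∈p)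

  vertices-++ʳ : ∀ {u v w} (p : Walk T u v) (q : Walk T v w) → vertices T q ⊆ vertices T (p ++ q)
  vertices-++ʳ stop q z∈q = z∈q
  vertices-++ʳ (step e p) q z∈q = there (vertices-++ʳ p q z∈q)

  vertices-++⁻ : ∀ {u v w z} (p : Walk T u v) (q : Walk T v w) →
    z ∈ vertices T (p ++ q) → z ∈ vertices T p ⊎ z ∈ vertices T q
  vertices-++⁻ stop q z∈q = inj₂ z∈q
  vertices-++⁻ (step e p) q (here refl) = inj₁ (here refl)
  vertices-++⁻ (step e p) q (there z∈pq) with vertices-++⁻ p q z∈pq
  ... | inj₁ z∈p = inj₁ (there z∈p)
  ... | inj₂ z∈q = inj₂ z∈q

  vertices-insert : ∀ {u v w} (p : Walk T u v) (e : Walk T v v) (q : Walk T v w) →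
    vertices T (p ++ q) ⊆ vertices T (p ++ e ++ q)
  vertices-insert p e q = [ vertices-++ˡ p _ , vertices-++ʳ p _ ∘ vertices-++ʳ e q ]′ ∘ vertices-++⁻ p q

  split-at : ∀ {u v z} (w : Walk T u v) → z ∈ vertices T w →
    Σ (Walk T u z) λ p → Σ (Walk T z v) λ q → w ≡ p ++ q
  split-at stop (here refl) = stop , stop , refl
  split-at (step e w) (here refl) = stop , step e w , refl
  split-at (step e w) (there z∈w) with split-at w z∈w
  ... | p , q , w≡p++q = step e p , q , cong (step e) w≡p++q

  reverseAdj : ∀ {u v} → Adj T u v → Adj T v u
  reverseAdj (up u≢root) = down u≢root
  reverseAdj (down v≢root) = up v≢root

  reverse : ∀ {u v} → Walk T u v → Walk T v u
  reverse stop = stop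
  reverse (step e w) = reverse w ++ step (reverseAdj e) stop

  length-reverse : ∀ {u v} (w : Walk T u v) → length T (reverse w) ≡ length T w
  length-reverse stop = refl
  length-reverse (step e w) = begin
    length T (reverse w ++ step (reverseAdj e) stop)  ≡⟨ length-++ (reverse w) _ ⟩
    length T (reverse w) + (weight (edgeOf T (reverseAdj e)) + 0)
      ≡⟨ cong₂ (λ ℓ x → ℓ + (x + 0)) (length-reverse w) (same-edge e) ⟩
    length T w + (weight (edgeOf T e) + 0)           ≡⟨ swap (length T w) (weight (edgeOf T e)) ⟩
    weight (edgeOf T e) + length T w                 ∎
    where
    open ≡-Reasoning
    same-edge : ∀ {u v} (e : Adj T u v) → weight (edgeOf T (reverseAdj e)) ≡ weight (edgeOf T e)
    same-edge (up _) = refl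
    same-edge (down _) = refl
    swap : ∀ x y → x + (y + 0) ≡ y + x
    swap = solve-∀

  visits-entrance : ∀ {u y v} (w : Walk T u y) → ¬ Ancestor T v u → Ancestor T v y → v ∈ vertices T w
  visits-entrance stop v∤u v∣y = ⊥-elim (v∤u v∣y)
  visits-entrance {u} {v = v} (step {v = u′} e w) v∤u v∣y with u′ ≟ᶠ v
  ... | yes refl = there (head∈vertices w)
  ... | no u′≢v = there (visits-entrance w (v∤u′ e) v∣y)
    where
    v∤u′ : Adj T u u′ → ¬ Ancestor T v u′
    v∤u′ (up _) v∣u′ = v∤u (ancestor-of-parent v∣u′)
    v∤u′ (down _) v∣u′ = v∤u (proper-ancestor v∣u′ u′≢v)

  visits-between : ∀ {a y z} (w : Walk T a y) → Ancestor T a z → Ancestor T z y → z ∈ vertices T w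
  visits-between {a} {z = z} w a∣z z∣y with z ≟ᶠ a
  ... | yes refl = head∈vertices w
  ... | no z≢a = visits-entrance w (z≢a ∘ ancestor-antisym a∣z) z∣y

  leaves-subtree : ∀ {u y v} (w : Walk T u y) → Ancestor T v u → ¬ Ancestor T v y →
    Σ (v ≢ root) λ v≢root → Σ (Walk T u v) λ p → Σ (Walk T (parent v) y) λ q →
      w ≡ p ++ step (up v≢root) q
  leaves-subtree stop v∣u v∤y = ⊥-elim (v∤y v∣u)
  leaves-subtree {v = v} (step (up {u} u≢root) w) v∣u v∤y with u ≟ᶠ v
  ... | yes refl = u≢root , stop , w , refl
  ... | no u≢v with leaves-subtree w (proper-ancestor v∣u u≢v) v∤y
  ...   | v≢root , p , q , w≡ = v≢root , step (up u≢root) p , q , cong (step (up u≢root)) w≡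
  leaves-subtree (step (down x≢root) w) v∣u v∤y with leaves-subtree w (ancestor-of-parent v∣u) v∤y
  ... | v≢root , p , q , w≡ = v≢root , step (down x≢root) p , q , cong (step (down x≢root)) w≡

  chain : ℕ → Vtx T → List (Vtx T)
  chain zero x = x ∷ []
  chain (suc k) x = x ∷ chain k (parent x)

  head∈chain : ∀ k x → x ∈ chain k x
  head∈chain zero x = here refl
  head∈chain (suc k) x = here refl

  top∈chain : ∀ k x → iter parent k x ∈ chain k x
  top∈chain zero x = here refl
  top∈chain (suc k) x = there (subst (_∈ chain k (parent x)) (iter-suc parent k x) (top∈chain k (parent x)))

  ∈-chain⇒between : ∀ k x {z} → z ∈ chain k x → Ancestor T (iter parent k x) z × Ancestor T z x
  ∈-chain⇒between zero x (here refl) = ancestor-refl x , ancestor-refl x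
  ∈-chain⇒between (suc k) x (here refl) = (suc k , refl) , ancestor-refl x
  ∈-chain⇒between (suc k) x (there z∈chain) with ∈-chain⇒between k (parent x) z∈chain
  ... | top∣z , z∣px = subst (λ t → Ancestor T t _) (iter-suc parent k x) top∣z , ancestor-of-parent z∣px

  chain-parent : ∀ k x {z} → z ∈ chain k x → z ≢ iter parent k x → parent z ∈ chain k x
  chain-parent zero x (here refl) z≢x = ⊥-elim (z≢x refl)
  chain-parent (suc k) x (here refl) _ = there (head∈chain k (parent x))
  chain-parent (suc k) x (there z∈chain) z≢top =
    there (chain-parent k (parent x) z∈chain (z≢top ∘ flip trans (iter-suc parent k x)))

  module Geodesics {dist : Vtx T → Vtx T → ℕ} (isDist : IsTreeDist T dist) where

    geodesic : ∀ u v → Walk T u v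
    geodesic u v = proj₁ (proj₁ (isDist u v))

    length-geodesic : ∀ u v → length T (geodesic u v) ≡ dist u v
    length-geodesic u v = proj₂ (proj₁ (isDist u v))

    dist-split : ∀ {u v z} (w : Walk T u v) → z ∈ vertices T w → dist u z + dist z v ≤ length T w
    dist-split w z∈w with split-at w z∈w
    ... | p , q , refl = subst (_ ≤_) (sym (length-++ p q))
                           (ℕP.+-mono-≤ (proj₂ (isDist _ _) p) (proj₂ (isDist _ _) q))

    dist-through-ancestor : ∀ {a b} → Ancestor T a b → dist root a + dist a b ≤ dist root b
    dist-through-ancestor {a} {b} a∣b = subst (_ ≤_) (length-geodesic root b)
      (dist-split (geodesic root b) (visits-between (geodesic root b) (reaches-root a) a∣b))

    round-trip : ∀ u {v} → Walk T v v → Walk T u u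
    round-trip u {v} t = geodesic u v ++ t ++ reverse (geodesic u v)

    vertices-round-trip : ∀ u {v} (t : Walk T v v) → vertices T t ⊆ vertices T (round-trip u t)
    vertices-round-trip u {v} t = vertices-++ʳ (geodesic u v) _ ∘ vertices-++ˡ t _

    length-round-trip : ∀ u {v} (t : Walk T v v) → length T (round-trip u t) ≡ 2 * dist u v + length T t
    length-round-trip u {v} t = begin
      length T (geodesic u v ++ t ++ reverse (geodesic u v))
        ≡⟨ trans (length-++ (geodesic u v) _) (cong (_+_ (length T (geodesic u v))) (length-++ t _)) ⟩
      length T (geodesic u v) + (length T t + length T (reverse (geodesic u v)))
        ≡⟨ cong (λ r → length T (geodesic u v) + (length T t + r)) (length-reverse (geodesic u v)) ⟩
      length T (geodesic u v) + (length T t + length T (geodesic u v))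
        ≡⟨ regroup (length T (geodesic u v)) (length T t) ⟩
      2 * length T (geodesic u v) + length T t
        ≡⟨ cong (λ d → 2 * d + length T t) (length-geodesic u v) ⟩
      2 * dist u v + length T t ∎
      where
      open ≡-Reasoning
      regroup : ∀ d ℓ → d + (ℓ + d) ≡ 2 * d + ℓ
      regroup = solve-∀

  module Absorb {k : ℕ} (comp : Vtx T → Fin k) (c : Fin k) (a : Vtx T)
                (below : ∀ x → VertexIn T comp c x → Ancestor T a x)
                (L : List (Vtx T)) (L-parent : ∀ {z} → z ∈ L → z ≢ a → parent z ∈ L) where

    ∈L-between : ∀ {x z} → z ∈ L → Ancestor T x z → Ancestor T a x → x ∈ L
    ∈L-between z∈L (j , z↑x) = climb j z∈L z↑x
      where
      climb : ∀ j {x z} → z ∈ L → iter parent j z ≡ x → Ancestor T a x → x ∈ L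
      climb zero z∈L refl _ = z∈L
      climb (suc j) {x} {z} z∈L z↑x a∣x with z ≟ᶠ a
      ... | yes refl = subst (_∈ L) (sym (ancestor-antisym a∣x (suc j , z↑x))) z∈L
      ... | no z≢a = climb j (L-parent z∈L z≢a) (trans (iter-suc parent j z) z↑x) a∣x

    WalkIn-++ : ∀ {u v w} (p : Walk T u v) (q : Walk T v w) →
      WalkIn T comp c (p ++ q) → WalkIn T comp c p × WalkIn T comp c q
    WalkIn-++ stop q q∈c = tt , q∈c
    WalkIn-++ (step e p) q (e∈c , pq∈c) with WalkIn-++ p q pq∈c
    ... | p∈c , q∈c = (e∈c , p∈c) , q∈c

    -- The result of splicing a walk w between two vertices of L into the closed walk t,
    -- which contains L: the steps of w along L are not paid for but returned as trace.
    record Absorption (t : Walk T a a) {u y} (w : Walk T u y) : Set where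
      field
        merged : Walk T a a
        keeps  : vertices T t ⊆ vertices T merged
        covers : vertices T w ⊆ vertices T merged
        trace  : Walk T u y
        saving : length T merged + length T trace ≤ length T t + length T w

    along : ∀ {t u u′ y} (e : Adj T u u′) {w : Walk T u′ y} → u ∈ L → L ⊆ vertices T t →
      Absorption t w → Absorption t (step e w)
    along {t} e {w} u∈L L⊆t r = record
      { merged = merged
      ; keeps = keeps
      ; covers = λ { (here refl) → keeps (L⊆t u∈L) ; (there z∈w) → covers z∈w }
      ; trace = step e trace
      ; saving = +-insert-≤ {length T merged} {length T trace} {length T t} {length T w} (weight (edgeOf T e)) saving
      }
      where open Absorption r

    detour : ∀ {u y} (t₁ : Walk T a u) (t₂ : Walk T u a) (e : Walk T u u) (q : Walk T u y) →
      Absorption (t₁ ++ e ++ t₂) q → Absorption (t₁ ++ t₂) (e ++ q)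
    detour t₁ t₂ e q r = record
      { merged = merged
      ; keeps = keeps ∘ vertices-insert t₁ e t₂
      ; covers = [ keeps ∘ vertices-++ʳ t₁ _ ∘ vertices-++ˡ e t₂ , covers ]′ ∘ vertices-++⁻ e q
      ; trace = trace
      ; saving = subst (length T merged + length T trace ≤_) length-detour saving
      }
      where
      open Absorption r
      open ≡-Reasoning
      regroup : ∀ x y z w → x + (y + z) + w ≡ x + z + (y + w)
      regroup = solve-∀
      length-detour : length T (t₁ ++ e ++ t₂) + length T q ≡ length T (t₁ ++ t₂) + length T (e ++ q)
      length-detour = begin
        length T (t₁ ++ e ++ t₂) + length T q
          ≡⟨ cong (_+ length T q) (trans (length-++ t₁ _) (cong (_+_ (length T t₁)) (length-++ e t₂))) ⟩
        length T t₁ + (length T e + length T t₂) + length T q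
          ≡⟨ regroup (length T t₁) (length T e) (length T t₂) (length T q) ⟩
        length T t₁ + length T t₂ + (length T e + length T q)
          ≡⟨ cong₂ _+_ (length-++ t₁ t₂) (length-++ e q) ⟨
        length T (t₁ ++ t₂) + length T (e ++ q) ∎

    absorb : ∀ {u y} (w : Walk T u y) → Acc _<_ (steps w) → WalkIn T comp c w → u ∈ L → y ∈ L →
      (t : Walk T a a) → L ⊆ vertices T t → Absorption t w
    absorb stop _ _ u∈L _ t L⊆t = record
      { merged = t ; keeps = id ; covers = λ { (here refl) → L⊆t u∈L } ; trace = stop ; saving = ℕP.≤-refl }
    absorb (step (up {u} u≢root) w) (acc rs) (u-edge , w∈c) u∈L y∈L t L⊆t =
      along (up u≢root) u∈L L⊆t (absorb w (rs ℕP.≤-refl) w∈c (L-parent u∈L u≢a) y∈L t L⊆t)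
      where
      u≢a : u ≢ a
      u≢a refl = ¬ancestor-of-parent u≢root (below (parent u) (u , u-edge , inj₂ refl))
    absorb (step (down {v} v≢root) w) (acc rs) (v-edge , w∈c) u∈L y∈L t L⊆t with v ∈? L
    ... | yes v∈L = along (down v≢root) u∈L L⊆t (absorb w (rs ℕP.≤-refl) w∈c v∈L y∈L t L⊆t)
    ... | no v∉L
      -- y ∈ L is not below v, so w returns to parent v through the edge v.
      with leaves-subtree w (ancestor-refl v)
             (λ v∣y → v∉L (∈L-between y∈L v∣y (below v (v , v-edge , inj₁ refl))))
    ... | v≢root′ , p , q , refl with split-at t (L⊆t u∈L)
    ... | t₁ , t₂ , refl =
      subst (Absorption (t₁ ++ t₂)) (cong (step (down v≢root)) (++-assoc p (step (up v≢root′) stop) q))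
        (detour t₁ t₂ excursion q
          (absorb q (rs (s≤s (ℕP.≤-trans (ℕP.n≤1+n _) (steps-++ʳ p _)))) q∈c u∈L y∈L
            (t₁ ++ excursion ++ t₂) (vertices-insert t₁ excursion t₂ ∘ L⊆t)))
      where
      excursion : Walk T (parent v) (parent v)
      excursion = step (down v≢root) (p ++ step (up v≢root′) stop)
      q∈c : WalkIn T comp c q
      q∈c = proj₂ (proj₂ (WalkIn-++ p _ w∈c))

    module _ {dist : Vtx T → Vtx T → ℕ} (isDist : IsTreeDist T dist) {b : Vtx T}
             (a∈L : a ∈ L) (b∈L : b ∈ L) where

      absorb-closed : (t : Walk T a a) → L ⊆ vertices T t →
        (s : Walk T a a) → WalkIn T comp c s → b ∈ vertices T s →
        Σ (Walk T a a) λ t′ → vertices T t ⊆ vertices T t′ × vertices T s ⊆ vertices T t′ ×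
          length T t′ + 2 * dist a b ≤ length T t + length T s
      absorb-closed t L⊆t s s∈c b∈s with split-at s b∈s
      ... | s₁ , s₂ , refl =
        r₂.merged , r₂.keeps ∘ r₁.keeps , [ r₂.keeps ∘ r₁.covers , r₂.covers ]′ ∘ vertices-++⁻ s₁ s₂ , saving
        where
        halves : WalkIn T comp c s₁ × WalkIn T comp c s₂
        halves = WalkIn-++ s₁ s₂ s∈c
        r₁ : Absorption t s₁
        r₁ = absorb s₁ (<-wellFounded _) (proj₁ halves) a∈L b∈L t L⊆t
        module r₁ = Absorption r₁
        r₂ : Absorption r₁.merged s₂
        r₂ = absorb s₂ (<-wellFounded _) (proj₂ halves) b∈L a∈L r₁.merged (r₁.keeps ∘ L⊆t)
        module r₂ = Absorption r₂
        d : ℕ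
        d = dist a b
        d≤trace₁ : d ≤ length T r₁.trace
        d≤trace₁ = proj₂ (isDist a b) r₁.trace
        d≤trace₂ : d ≤ length T r₂.trace
        d≤trace₂ = subst (d ≤_) (length-reverse r₂.trace) (proj₂ (isDist a b) (reverse r₂.trace))
        double : ∀ x → 2 * x ≡ x + x
        double = solve-∀
        swap : ∀ x y z → x + y + z ≡ x + z + y
        swap = solve-∀
        open ℕP.≤-Reasoning
        saving : length T r₂.merged + 2 * d ≤ length T t + length T (s₁ ++ s₂)
        saving = begin
          length T r₂.merged + 2 * d                ≡⟨ cong (_+_ (length T r₂.merged)) (double d) ⟩
          length T r₂.merged + (d + d)              ≤⟨ ℕP.+-monoʳ-≤ (length T r₂.merged) (ℕP.+-mono-≤ d≤trace₂ d≤trace₁) ⟩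
          length T r₂.merged + (length T r₂.trace + length T r₁.trace) ≡⟨ ℕP.+-assoc (length T r₂.merged) _ _ ⟨
          length T r₂.merged + length T r₂.trace + length T r₁.trace   ≤⟨ ℕP.+-monoˡ-≤ (length T r₁.trace) r₂.saving ⟩
          length T r₁.merged + length T s₂ + length T r₁.trace         ≡⟨ swap (length T r₁.merged) _ _ ⟩
          length T r₁.merged + length T r₁.trace + length T s₂         ≤⟨ ℕP.+-monoˡ-≤ (length T s₂) r₁.saving ⟩
          length T t + length T s₁ + length T s₂  ≡⟨ ℕP.+-assoc (length T t) _ _ ⟩
          length T t + (length T s₁ + length T s₂) ≡⟨ cong (_+_ (length T t)) (length-++ s₁ s₂) ⟨
          length T t + length T (s₁ ++ s₂)        ∎

      absorb-all : (t : Walk T a a) → L ⊆ vertices T t →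
        ∀ m (s : Fin m → Walk T a a) → (∀ i → WalkIn T comp c (s i)) → (∀ i → b ∈ vertices T (s i)) →
        Σ (Walk T a a) λ t′ → vertices T t ⊆ vertices T t′ × (∀ i → vertices T (s i) ⊆ vertices T t′) ×
          length T t′ + m * (2 * dist a b) ≤ length T t + sumℕ m (length T ∘ s)
      absorb-all t L⊆t zero s s∈c b∈s = t , id , (λ ()) , ℕP.≤-refl
      absorb-all t L⊆t (suc m) s s∈c b∈s
        with absorb-closed t L⊆t (s Fin.zero) (s∈c Fin.zero) (b∈s Fin.zero)
      ... | t₁ , t⊆t₁ , s₀⊆t₁ , saving₁
        with absorb-all t₁ (t⊆t₁ ∘ L⊆t) m (s ∘ Fin.suc) (s∈c ∘ Fin.suc) (b∈s ∘ Fin.suc)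
      ... | t₂ , t₁⊆t₂ , rest⊆t₂ , saving₂ = t₂ , t₁⊆t₂ ∘ t⊆t₁ , covers , saving
        where
        covers : ∀ i → vertices T (s i) ⊆ vertices T t₂
        covers Fin.zero = t₁⊆t₂ ∘ s₀⊆t₁
        covers (Fin.suc i) = rest⊆t₂ i
        X S : ℕ
        X = 2 * dist a b
        S = sumℕ m (length T ∘ s ∘ Fin.suc)
        swap : ∀ x y z → x + (y + z) ≡ x + z + y
        swap = solve-∀
        open ℕP.≤-Reasoning
        saving : length T t₂ + (X + m * X) ≤ length T t + (length T (s Fin.zero) + S)
        saving = begin
          length T t₂ + (X + m * X)  ≡⟨ swap (length T t₂) X (m * X) ⟩
          length T t₂ + m * X + X    ≤⟨ ℕP.+-monoˡ-≤ X saving₂ ⟩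
          length T t₁ + S + X        ≡⟨ swap (length T t₁) X S ⟨
          length T t₁ + (X + S)      ≡⟨ ℕP.+-assoc (length T t₁) X S ⟨
          length T t₁ + X + S        ≤⟨ ℕP.+-monoˡ-≤ S saving₁ ⟩
          length T t + length T (s Fin.zero) + S ≡⟨ ℕP.+-assoc (length T t) _ S ⟩
          length T t + (length T (s Fin.zero) + S) ∎

  module _ {k} (comp : Vtx T → Fin k) (c : Fin k)
           {dist : Vtx T → Vtx T → ℕ} (isDist : IsTreeDist T dist) where
    open Geodesics isDist

    closed-walk-through : ∀ {a} → (∀ x → VertexIn T comp c x → Ancestor T a x) →
      ∀ {b} → Ancestor T a b → ∀ m (s : Fin m → Walk T a a) →
      (∀ i → WalkIn T comp c (s i)) → (∀ i → b ∈ vertices T (s i)) →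
      Σ (Walk T a a) λ t → (∀ i → vertices T (s i) ⊆ vertices T t) ×
        length T t + m * (2 * dist a b) ≤ 2 * dist a b + sumℕ m (length T ∘ s)
    closed-walk-through {a} below {b} (j , refl) m s s∈c b∈s =
      let t , _ , covers , saving = absorb-all isDist (top∈chain j b) (head∈chain j b) t₀ L⊆t₀ m s s∈c b∈s
      in t , covers , subst (λ ℓ → length T t + m * (2 * dist a b) ≤ ℓ + sumℕ m (length T ∘ s)) length-t₀ saving
      where
      open Absorb comp c a below (chain j b) (chain-parent j b)
      t₀ : Walk T a a
      t₀ = round-trip a stop
      L⊆t₀ : chain j b ⊆ vertices T t₀
      L⊆t₀ z∈L = vertices-++ˡ (geodesic a b) _
        (visits-between (geodesic a b) (proj₁ (∈-chain⇒between j b z∈L)) (proj₂ (∈-chain⇒between j b z∈L)))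
      length-t₀ : length T t₀ ≡ 2 * dist a b
      length-t₀ = trans (length-round-trip a stop) (ℕP.+-identityʳ _)

    tour-through : ∀ {a} → (∀ x → VertexIn T comp c x → Ancestor T a x) →
      ∀ {b} → Ancestor T a b → ∀ m (s : Fin m → Walk T a a) →
      (∀ i → WalkIn T comp c (s i)) → (∀ i → b ∈ vertices T (s i)) →
      Σ (Walk T root root) λ tour → (∀ i → vertices T (s i) ⊆ vertices T tour) ×
        length T tour + m * (2 * dist a b) ≤ 2 * dist root b + sumℕ m (length T ∘ s)
    tour-through {a} below {b} a∣b m s s∈c b∈s =
      let t , covers , saving = closed-walk-through below a∣b m s s∈c b∈s
      in round-trip root t , (λ i → vertices-round-trip root t ∘ covers i) , bound t saving
      where
      X Σs : ℕ
      X = 2 * dist a b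
      Σs = sumℕ m (length T ∘ s)
      regroup : ∀ r d σ → 2 * r + (2 * d + σ) ≡ 2 * (r + d) + σ
      regroup = solve-∀
      open ℕP.≤-Reasoning
      bound : (t : Walk T a a) → length T t + m * X ≤ X + Σs →
        length T (round-trip root t) + m * X ≤ 2 * dist root b + Σs
      bound t saving = begin
        length T (round-trip root t) + m * X   ≡⟨ cong (_+ m * X) (length-round-trip root t) ⟩
        2 * dist root a + length T t + m * X   ≡⟨ ℕP.+-assoc (2 * dist root a) (length T t) (m * X) ⟩
        2 * dist root a + (length T t + m * X) ≤⟨ ℕP.+-monoʳ-≤ (2 * dist root a) saving ⟩
        2 * dist root a + (X + Σs)             ≡⟨ regroup (dist root a) (dist a b) Σs ⟩
        2 * (dist root a + dist a b) + Σs      ≤⟨ ℕP.+-monoˡ-≤ Σs (ℕP.*-monoʳ-≤ 2 (dist-through-ancestor a∣b)) ⟩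
        2 * dist root b + Σs                   ∎

open RootedTree
open Components

lemma12 : (T : RootedTree) (U : Vtx T → Set) (D : ℕ) → 1 ≤ D →
    (dist : Vtx T → Vtx T → ℕ) → IsTreeDist T dist →
    (k : ℕ) (C : Components T k) →
    (∀ c → 2 * dist (root T) (croot C c) < D) →
    (∀ c → IsInternal C c → 2 * dist (root T) (exit C c) < D) →
    (c : Fin k) (m : ℕ) → 1 ≤ m →
    (s : Fin m → Walk T (croot C c) (croot C c)) →
    (∀ i → IsSubtour T C U c (s i)) →
    (cat : Category T) → (∀ i → HasCategory T C c cat (s i)) →
    sumℚ m (λ i → reducedLength T dist D C c cat (s i)) ≤ℚ 1ℚ →
    Σ (Walk T (root T) (root T)) (λ t →
      length T t ≤ D × (∀ i x → U x → x ∈ vertices T (s i) → x ∈ vertices T t))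
lemma12 T U D _ dist isDist k C root-fits exit-fits c m _ s subtour ending _ reduced≤1 =
  let tour , covers , bound = Tree.tour-through T (comp C) c isDist (croot-closest C c) (0 , refl)
                                m s (proj₁ ∘ subtour) (Tree.head∈vertices T ∘ s)
  in tour , within-budget bound (ℕP.m≤n⇒m≤n+o _ lengths≤) (ℕP.<⇒≤ (root-fits c)) , λ i _ _ → covers i
  where
  lengths≤ : sumℕ m (length T ∘ s) ≤ D ∸ 2 * dist (root T) (croot C c)
  lengths≤ = sumℚ-frac≤1⇒sumℕ≤ _ (ℕP.m<n⇒0<n∸m (root-fits c)) m _ reduced≤1
lemma12 T U D _ dist isDist k C root-fits exit-fits c m 1≤m s subtour passing passes reduced≤1 =
  let tour , covers , bound = Tree.tour-through T (comp C) c isDist (croot-closest C c)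
                                (croot-closest C c (exit C c) (exit-in C c internal))
                                m s (proj₁ ∘ subtour) (proj₂ ∘ passes)
  in tour , within-budget bound lengths≤ (ℕP.<⇒≤ (exit-fits c internal)) , λ i _ _ → covers i
  where
  internal : IsInternal C c
  internal = proj₁ (passes (fromℕ< 1≤m))
  lengths≤ : sumℕ m (length T ∘ s) ≤
             (D ∸ 2 * dist (root T) (exit C c)) + m * (2 * dist (croot C c) (exit C c))
  lengths≤ = sumℚ-frac-sub≤1⇒sumℕ≤ _ (ℕP.m<n⇒0<n∸m (exit-fits c internal)) m _ _ reduced≤1
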